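{- Let $\{P_n(x)\}_{n\ge 1}$ be the sequence defined in the context. For all integers $n\ge 1$ and $k\ge 1$, $$P_n(k)=\begin{cases}\dfrac{\binom{(n-1)/2+k-1}{k-1}}{\binom{n+2k-2}{k-1}}\left(\frac{n-1}{2}\right)!\,T_n(k), & n \text{ odd},\\[2ex] \dfrac{\binom{n/2+k-1}{k}}{\binom{n+2k-1}{k}}\left(\frac{n}{2}-1\right)!\,T_n(k), & n\text{ even},\end{cases}$$ and also $$P_n(k)=2^{ -(\lfloor n/2\rfloor+k-1)}\,\frac{(n+k-1)!}{(2\lfloor n/2\rfloor+2k-1)!!}\,T_n(k),$$ where $T_n(k)=\sum_{i=1}^{n}2^{i-1}\binom{n+2k-i-1}{k-1}$.
   Context: The sequence $\{P_n(x)\}_{n\ge1}$ of rational functions of $x$ is defined by $P_1=P_2=1$ and, for $n\ge 2$: if $n$ is odd, $4(2x+n)P_{n+1}(x)=2(x+n)P_n(x)+(2x+n)P_n(x+1)+(4x+n)\ell_n(x)$; if $n$ is even, $4P_{n+1}(x)=4(x+n)P_n(x)+2(2x+n+1)P_n(x+1)+(4x+n)\ell_{n-1}(x)$. Here for odd $r\ge1$, $\ell_r(x)=\prod_{j=1}^{(r-1)/2}(x+j)$ (the empty product equals $1$). For a positive integer $N$, $N!!$ denotes the product of all positive integers $\le N$ having the same parity as $N$. -}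

module Defs where

open import Data.Nat as ℕ using (ℕ; zero; suc; _∸_; _^_; _%_; _/_)
open import Data.Nat.ListAction using (sum)
open import Data.Nat.Combinatorics using (_C_)
open import Data.List using (List; map; upTo)
open import Data.Integer using (+_)
open import Data.Rational as ℚ using (ℚ; 0ℚ; 1ℚ)

⟦_⟧ : ℕ → ℚ
⟦ n ⟧ = + n ℚ./ 1

-- reciprocal of a natural number (only ever applied to nonzero arguments;
-- the value at 0 is an irrelevant junk value)
inv : ℕ → ℚ
inv zero    = 0ℚ
inv (suc n) = + 1 ℚ./ suc n

ℓ : ℕ → ℕ → ℚ
ℓ r k = Data.List.foldr ℚ._*_ 1ℚ (map (λ j → ⟦ k ℕ.+ suc j ⟧) (upTo ((r ∸ 1) / 2)))

-- one step of the recursion: given n ≥ 2 and f = P_n (as a function of the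
-- argument), compute P_{n+1}(k)
step : ℕ → (ℕ → ℚ) → ℕ → ℚ
step n f k with n % 2
... | zero  =
  inv 4 ℚ.* ( ⟦ 4 ℕ.* (k ℕ.+ n) ⟧ ℚ.* f k
            ℚ.+ ⟦ 2 ℕ.* (2 ℕ.* k ℕ.+ n ℕ.+ 1) ⟧ ℚ.* f (suc k)
            ℚ.+ ⟦ 4 ℕ.* k ℕ.+ n ⟧ ℚ.* ℓ (n ∸ 1) k )
... | suc _ =
  inv (4 ℕ.* (2 ℕ.* k ℕ.+ n)) ℚ.*
            ( ⟦ 2 ℕ.* (k ℕ.+ n) ⟧ ℚ.* f k
            ℚ.+ ⟦ 2 ℕ.* k ℕ.+ n ⟧ ℚ.* f (suc k)
            ℚ.+ ⟦ 4 ℕ.* k ℕ.+ n ⟧ ℚ.* ℓ n k )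

-- P n k = P_n(k)  (value of the rational function P_n at the natural number k).
-- P 0 is unused junk.
P : ℕ → ℕ → ℚ
P zero k = 0ℚ
P (suc zero) k = 1ℚ
P (suc (suc zero)) k = 1ℚ
P (suc (suc (suc m))) k = step (suc (suc m)) (P (suc (suc m))) k

_!! : ℕ → ℕ
zero !! = 1
suc zero !! = 1
suc (suc n) !! = suc (suc n) ℕ.* (n !!)

-- T_n(k) = Σ_{i=1}^{n} 2^{i-1} C(n+2k-i-1, k-1)   (summation index j = i - 1)
T : ℕ → ℕ → ℕ
T n k = sum (map (λ j → 2 ^ j ℕ.* ((n ℕ.+ 2 ℕ.* k ∸ suc j ∸ 1) C (k ∸ 1))) (upTo n))

{-# OPTIONS --safe #-}
-- With b = ⌊n/2⌋ + k − 1, all forms say P_n(k) = T_n(k) (n+k−1)! / (2^b (2b+1)!!),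
-- and the binomial ones follow from (2b+1)! = b! 2^b (2b+1)!!.  Over the common denominator
-- 2^(b+1) (2b+3)!!, one step of the recurrence becomes the identity
--   4q T_n(k) + q T_n(k+1) + (q+3k) C(n+2k−1, k) = 4q T_{n+1}(k),   q = n + k,
-- which combines T_{n+1}(k) = 2 T_n(k) + C(n+2k−1, k−1), the shift relation
-- T_n(k+1) + C(n+2k−1, k) = 4 T_n(k) + C(n+2k−1, k−1) (induction on n with Pascal's
-- rule) and the absorption identity q C(n+2k−1, k−1) = k C(n+2k−1, k).
module Submission where

open import Defs
open import Data.Nat
  using (ℕ; zero; suc; _!; _∸_; _^_; _%_; _/_; _≤_; _+_; _*_; NonZero; ≢-nonZero; s≤s; z≤n)
open import Data.Nat.Properties
open import Data.Nat.DivMod using (m/n*n≡m; m*n/n≡m; [m+kn]%n≡m%n; m/n≡1+[m∸n]/n)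
open import Data.Nat.Combinatorics
  using (_C_; nCk≡n!/k![n-k]!; k![n∸k]!∣n!; nCk+nC[k+1]≡[n+1]C[k+1]; nCk≡nC[n∸k])
open import Data.Nat.ListAction using (sum)
open import Data.Nat.Tactic.RingSolver using () renaming (ring to ℕ-ring)
import Data.Integer as ℤ
import Data.Integer.Properties as ℤ
import Data.Integer.Tactic.RingSolver as ℤ-ring
open import Data.Rational as ℚ using (ℚ; 1ℚ)
import Data.Rational.Properties as ℚ
import Data.Rational.Unnormalised as ℚᵘ
import Data.Rational.Unnormalised.Properties as ℚᵘ
open import Data.List using (List; []; _∷_; map; upTo; applyUpTo; foldr)
open import Data.List.Properties using (map-applyUpTo; map-upTo; map-cong)
open import Data.Product using (_×_; _,_; Σ-syntax)
open import Data.Sum using (_⊎_; inj₁; inj₂)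
open import Function using (_∘_)
open import Level using (0ℓ)
open import Data.Maybe using (nothing)
open import Relation.Binary.PropositionalEquality
open import Relation.Nullary using (contradiction)
open import Tactic.RingSolver using (solve-∀; solve)
open import Tactic.RingSolver.Core.AlmostCommutativeRing using (AlmostCommutativeRing; fromCommutativeRing)

-- Natural numbers as rationals

ℚ-ring : AlmostCommutativeRing 0ℓ 0ℓ
ℚ-ring = fromCommutativeRing ℚ.+-*-commutativeRing (λ _ → nothing)

toℚᵘ-⟦⟧ : ∀ n → ℚ.toℚᵘ ⟦ n ⟧ ℚᵘ.≃ ℚᵘ.mkℚᵘ (ℤ.+ n) 0
toℚᵘ-⟦⟧ n = ℚ.toℚᵘ-fromℚᵘ (ℚᵘ.mkℚᵘ (ℤ.+ n) 0)

⟦⟧-homo-+ : ∀ m n → ⟦ m + n ⟧ ≡ ⟦ m ⟧ ℚ.+ ⟦ n ⟧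
⟦⟧-homo-+ m n = ℚ.toℚᵘ-injective (begin
  ℚ.toℚᵘ ⟦ m + n ⟧                      ≈⟨ toℚᵘ-⟦⟧ (m + n) ⟩
  ℚᵘ.mkℚᵘ (ℤ.+ (m + n)) 0                 ≈⟨ ℚᵘ.*≡* (trans (cong (ℤ._* ℤ.+ 1) (ℤ.pos-+ m n)) (over-1 (ℤ.+ m) (ℤ.+ n))) ⟩
  ℚᵘ.mkℚᵘ (ℤ.+ m) 0 ℚᵘ.+ ℚᵘ.mkℚᵘ (ℤ.+ n) 0  ≈⟨ ℚᵘ.≃-sym (ℚᵘ.+-cong (toℚᵘ-⟦⟧ m) (toℚᵘ-⟦⟧ n)) ⟩
  ℚ.toℚᵘ ⟦ m ⟧ ℚᵘ.+ ℚ.toℚᵘ ⟦ n ⟧        ≈⟨ ℚᵘ.≃-sym (ℚ.toℚᵘ-homo-+ ⟦ m ⟧ ⟦ n ⟧) ⟩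
  ℚ.toℚᵘ (⟦ m ⟧ ℚ.+ ⟦ n ⟧)               ∎)
  where
  open ℚᵘ.≃-Reasoning
  over-1 : ∀ x y → (x ℤ.+ y) ℤ.* ℤ.+ 1 ≡ (x ℤ.* ℤ.+ 1 ℤ.+ y ℤ.* ℤ.+ 1) ℤ.* ℤ.+ 1
  over-1 = ℤ-ring.solve-∀

⟦⟧-homo-* : ∀ m n → ⟦ m * n ⟧ ≡ ⟦ m ⟧ ℚ.* ⟦ n ⟧
⟦⟧-homo-* m n = ℚ.toℚᵘ-injective (begin
  ℚ.toℚᵘ ⟦ m * n ⟧                      ≈⟨ toℚᵘ-⟦⟧ (m * n) ⟩
  ℚᵘ.mkℚᵘ (ℤ.+ (m * n)) 0                 ≈⟨ ℚᵘ.*≡* (cong (ℤ._* ℤ.+ 1) (ℤ.pos-* m n)) ⟩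
  ℚᵘ.mkℚᵘ (ℤ.+ m) 0 ℚᵘ.* ℚᵘ.mkℚᵘ (ℤ.+ n) 0  ≈⟨ ℚᵘ.≃-sym (ℚᵘ.*-cong (toℚᵘ-⟦⟧ m) (toℚᵘ-⟦⟧ n)) ⟩
  ℚ.toℚᵘ ⟦ m ⟧ ℚᵘ.* ℚ.toℚᵘ ⟦ n ⟧        ≈⟨ ℚᵘ.≃-sym (ℚ.toℚᵘ-homo-* ⟦ m ⟧ ⟦ n ⟧) ⟩
  ℚ.toℚᵘ (⟦ m ⟧ ℚ.* ⟦ n ⟧)               ∎)
  where open ℚᵘ.≃-Reasoning

⟦⟧*inv≡1 : ∀ n .{{_ : NonZero n}} → ⟦ n ⟧ ℚ.* inv n ≡ 1ℚ
⟦⟧*inv≡1 (suc n) = ℚ.toℚᵘ-injective (begin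
  ℚ.toℚᵘ (⟦ suc n ⟧ ℚ.* inv (suc n))                    ≈⟨ ℚ.toℚᵘ-homo-* ⟦ suc n ⟧ (inv (suc n)) ⟩
  ℚ.toℚᵘ ⟦ suc n ⟧ ℚᵘ.* ℚ.toℚᵘ (inv (suc n))           ≈⟨ ℚᵘ.*-cong (toℚᵘ-⟦⟧ (suc n)) (ℚ.toℚᵘ-fromℚᵘ (ℚᵘ.mkℚᵘ (ℤ.+ 1) n)) ⟩
  ℚᵘ.mkℚᵘ (ℤ.+ suc n) 0 ℚᵘ.* ℚᵘ.mkℚᵘ (ℤ.+ 1) n             ≈⟨ ℚᵘ.*≡* (cross-1 (ℤ.+ suc n)) ⟩
  ℚ.toℚᵘ 1ℚ                                             ∎)
  where
  open ℚᵘ.≃-Reasoning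
  cross-1 : ∀ x → x ℤ.* ℤ.+ 1 ℤ.* ℤ.+ 1 ≡ ℤ.+ 1 ℤ.* (ℤ.+ 1 ℤ.* x)
  cross-1 = ℤ-ring.solve-∀

*-cancelˡ-⟦⟧ : ∀ u {x y} .{{_ : NonZero u}} → ⟦ u ⟧ ℚ.* x ≡ ⟦ u ⟧ ℚ.* y → x ≡ y
*-cancelˡ-⟦⟧ u {x} {y} eq = begin
  x                              ≡⟨ unit x ⟩
  inv u ℚ.* (⟦ u ⟧ ℚ.* x)        ≡⟨ cong (inv u ℚ.*_) eq ⟩
  inv u ℚ.* (⟦ u ⟧ ℚ.* y)        ≡⟨ unit y ⟨
  y                              ∎
  where
  open ≡-Reasoning
  unit : ∀ z → z ≡ inv u ℚ.* (⟦ u ⟧ ℚ.* z)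
  unit z = begin
    z                              ≡⟨ ℚ.*-identityˡ z ⟨
    1ℚ ℚ.* z                       ≡⟨ cong (ℚ._* z) (⟦⟧*inv≡1 u) ⟨
    ⟦ u ⟧ ℚ.* inv u ℚ.* z          ≡⟨ cong (ℚ._* z) (ℚ.*-comm ⟦ u ⟧ (inv u)) ⟩
    inv u ℚ.* ⟦ u ⟧ ℚ.* z          ≡⟨ ℚ.*-assoc (inv u) ⟦ u ⟧ z ⟩
    inv u ℚ.* (⟦ u ⟧ ℚ.* z)        ∎

-- Opaque so that unification compares numerators and denominators instead of
-- unfolding the normalisation of rationals.
opaque
  frac : ℕ → ℕ → ℚ
  frac p u = ⟦ p ⟧ ℚ.* inv u

  frac-def : ∀ p u → frac p u ≡ ⟦ p ⟧ ℚ.* inv u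
  frac-def p u = refl

frac-1-1 : frac 1 1 ≡ 1ℚ
frac-1-1 = frac-def 1 1

⟦⟧*frac : ∀ p u .{{_ : NonZero u}} → ⟦ u ⟧ ℚ.* frac p u ≡ ⟦ p ⟧
⟦⟧*frac p u = begin
  ⟦ u ⟧ ℚ.* frac p u           ≡⟨ cong (⟦ u ⟧ ℚ.*_) (frac-def p u) ⟩
  ⟦ u ⟧ ℚ.* (⟦ p ⟧ ℚ.* inv u)  ≡⟨ ℚ.*-assoc ⟦ u ⟧ ⟦ p ⟧ (inv u) ⟨
  ⟦ u ⟧ ℚ.* ⟦ p ⟧ ℚ.* inv u    ≡⟨ cong (ℚ._* inv u) (ℚ.*-comm ⟦ u ⟧ ⟦ p ⟧) ⟩
  ⟦ p ⟧ ℚ.* ⟦ u ⟧ ℚ.* inv u    ≡⟨ ℚ.*-assoc ⟦ p ⟧ ⟦ u ⟧ (inv u) ⟩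
  ⟦ p ⟧ ℚ.* (⟦ u ⟧ ℚ.* inv u)  ≡⟨ cong (⟦ p ⟧ ℚ.*_) (⟦⟧*inv≡1 u) ⟩
  ⟦ p ⟧ ℚ.* 1ℚ                 ≡⟨ ℚ.*-identityʳ ⟦ p ⟧ ⟩
  ⟦ p ⟧                        ∎
  where open ≡-Reasoning

frac-cross : ∀ p q u v .{{_ : NonZero u}} .{{_ : NonZero v}} → p * v ≡ q * u → frac p u ≡ frac q v
frac-cross p q u v pv≡qu = *-cancelˡ-⟦⟧ (u * v) {{m*n≢0 u v}} (begin
  ⟦ u * v ⟧ ℚ.* frac p u        ≡⟨ scale p u v ⟩
  ⟦ p * v ⟧                     ≡⟨ cong ⟦_⟧ pv≡qu ⟩
  ⟦ q * u ⟧                     ≡⟨ scale q v u ⟨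
  ⟦ v * u ⟧ ℚ.* frac q v        ≡⟨ cong (λ w → ⟦ w ⟧ ℚ.* frac q v) (*-comm v u) ⟩
  ⟦ u * v ⟧ ℚ.* frac q v        ∎)
  where
  open ≡-Reasoning
  scale : ∀ r s t .{{_ : NonZero s}} → ⟦ s * t ⟧ ℚ.* frac r s ≡ ⟦ r * t ⟧
  scale r s t = begin
    ⟦ s * t ⟧ ℚ.* frac r s          ≡⟨ cong (ℚ._* frac r s) (trans (⟦⟧-homo-* s t) (ℚ.*-comm ⟦ s ⟧ ⟦ t ⟧)) ⟩
    ⟦ t ⟧ ℚ.* ⟦ s ⟧ ℚ.* frac r s    ≡⟨ ℚ.*-assoc ⟦ t ⟧ ⟦ s ⟧ (frac r s) ⟩
    ⟦ t ⟧ ℚ.* (⟦ s ⟧ ℚ.* frac r s)  ≡⟨ cong (⟦ t ⟧ ℚ.*_) (⟦⟧*frac r s) ⟩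
    ⟦ t ⟧ ℚ.* ⟦ r ⟧                 ≡⟨ trans (ℚ.*-comm ⟦ t ⟧ ⟦ r ⟧) (sym (⟦⟧-homo-* r t)) ⟩
    ⟦ r * t ⟧                       ∎

inv-* : ∀ u v .{{_ : NonZero u}} .{{_ : NonZero v}} → inv (u * v) ≡ inv u ℚ.* inv v
inv-* u v = *-cancelˡ-⟦⟧ (u * v) {{m*n≢0 u v}} (begin
  ⟦ u * v ⟧ ℚ.* inv (u * v)                       ≡⟨ ⟦⟧*inv≡1 (u * v) {{m*n≢0 u v}} ⟩
  1ℚ                                               ≡⟨ cong₂ ℚ._*_ (⟦⟧*inv≡1 u) (⟦⟧*inv≡1 v) ⟨
  (⟦ u ⟧ ℚ.* inv u) ℚ.* (⟦ v ⟧ ℚ.* inv v)         ≡⟨ swap ⟦ u ⟧ (inv u) ⟦ v ⟧ (inv v) ⟩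
  ⟦ u ⟧ ℚ.* ⟦ v ⟧ ℚ.* (inv u ℚ.* inv v)           ≡⟨ cong (ℚ._* (inv u ℚ.* inv v)) (⟦⟧-homo-* u v) ⟨
  ⟦ u * v ⟧ ℚ.* (inv u ℚ.* inv v)                 ∎)
  where
  open ≡-Reasoning
  swap : ∀ a b c d → (a ℚ.* b) ℚ.* (c ℚ.* d) ≡ a ℚ.* c ℚ.* (b ℚ.* d)
  swap = solve-∀ ℚ-ring

inv*-frac-sum : ∀ e u c₁ c₂ c₃ x y z .{{_ : NonZero e}} .{{_ : NonZero u}} →
  inv e ℚ.* (⟦ c₁ ⟧ ℚ.* frac x u ℚ.+ ⟦ c₂ ⟧ ℚ.* frac y u ℚ.+ ⟦ c₃ ⟧ ℚ.* frac z u)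
    ≡ frac (c₁ * x + c₂ * y + c₃ * z) (e * u)
inv*-frac-sum e u c₁ c₂ c₃ x y z = begin
  inv e ℚ.* (⟦ c₁ ⟧ ℚ.* frac x u ℚ.+ ⟦ c₂ ⟧ ℚ.* frac y u ℚ.+ ⟦ c₃ ⟧ ℚ.* frac z u)
    ≡⟨ cong₂ (λ p q → inv e ℚ.* (p ℚ.+ q)) (cong₂ (λ p q → ⟦ c₁ ⟧ ℚ.* p ℚ.+ ⟦ c₂ ⟧ ℚ.* q) (frac-def x u) (frac-def y u)) (cong (⟦ c₃ ⟧ ℚ.*_) (frac-def z u)) ⟩
  inv e ℚ.* (⟦ c₁ ⟧ ℚ.* (⟦ x ⟧ ℚ.* inv u) ℚ.+ ⟦ c₂ ⟧ ℚ.* (⟦ y ⟧ ℚ.* inv u) ℚ.+ ⟦ c₃ ⟧ ℚ.* (⟦ z ⟧ ℚ.* inv u))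
    ≡⟨ distrib (inv e) (inv u) ⟦ c₁ ⟧ ⟦ c₂ ⟧ ⟦ c₃ ⟧ ⟦ x ⟧ ⟦ y ⟧ ⟦ z ⟧ ⟩
  (⟦ c₁ ⟧ ℚ.* ⟦ x ⟧ ℚ.+ ⟦ c₂ ⟧ ℚ.* ⟦ y ⟧ ℚ.+ ⟦ c₃ ⟧ ℚ.* ⟦ z ⟧) ℚ.* (inv e ℚ.* inv u)
    ≡⟨ cong₂ ℚ._*_ (sym ⟦sum⟧) (sym (inv-* e u)) ⟩
  ⟦ c₁ * x + c₂ * y + c₃ * z ⟧ ℚ.* inv (e * u)
    ≡⟨ frac-def (c₁ * x + c₂ * y + c₃ * z) (e * u) ⟨
  frac (c₁ * x + c₂ * y + c₃ * z) (e * u) ∎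
  where
  open ≡-Reasoning
  distrib : ∀ i j a b c p q r →
    i ℚ.* (a ℚ.* (p ℚ.* j) ℚ.+ b ℚ.* (q ℚ.* j) ℚ.+ c ℚ.* (r ℚ.* j)) ≡ (a ℚ.* p ℚ.+ b ℚ.* q ℚ.+ c ℚ.* r) ℚ.* (i ℚ.* j)
  distrib = solve-∀ ℚ-ring
  ⟦sum⟧ : ⟦ c₁ * x + c₂ * y + c₃ * z ⟧ ≡ ⟦ c₁ ⟧ ℚ.* ⟦ x ⟧ ℚ.+ ⟦ c₂ ⟧ ℚ.* ⟦ y ⟧ ℚ.+ ⟦ c₃ ⟧ ℚ.* ⟦ z ⟧
  ⟦sum⟧ = begin
    ⟦ c₁ * x + c₂ * y + c₃ * z ⟧             ≡⟨ ⟦⟧-homo-+ (c₁ * x + c₂ * y) (c₃ * z) ⟩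
    ⟦ c₁ * x + c₂ * y ⟧ ℚ.+ ⟦ c₃ * z ⟧       ≡⟨ cong (ℚ._+ ⟦ c₃ * z ⟧) (⟦⟧-homo-+ (c₁ * x) (c₂ * y)) ⟩
    ⟦ c₁ * x ⟧ ℚ.+ ⟦ c₂ * y ⟧ ℚ.+ ⟦ c₃ * z ⟧ ≡⟨ cong₂ ℚ._+_ (cong₂ ℚ._+_ (⟦⟧-homo-* c₁ x) (⟦⟧-homo-* c₂ y)) (⟦⟧-homo-* c₃ z) ⟩
    ⟦ c₁ ⟧ ℚ.* ⟦ x ⟧ ℚ.+ ⟦ c₂ ⟧ ℚ.* ⟦ y ⟧ ℚ.+ ⟦ c₃ ⟧ ℚ.* ⟦ z ⟧ ∎

-- Factorials, double factorials and binomial coefficients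

2*[1+n]≡2+2*n : ∀ n → 2 * suc n ≡ suc (suc (2 * n))
2*[1+n]≡2+2*n n = *-distribˡ-+ 2 1 n

n!!≢0 : ∀ n → NonZero (n !!)
n!!≢0 zero          = _
n!!≢0 (suc zero)    = _
n!!≢0 (suc (suc n)) = m*n≢0 (suc (suc n)) (n !!) {{_}} {{n!!≢0 n}}

-- den b = 2^b (2b+1)!! = (2b+1)!/b!; for b = ⌊n/2⌋ + k − 1 it is the denominator of the closed form.
den : ℕ → ℕ
den b = 2 ^ b * suc (2 * b) !!

den≢0 : ∀ b → NonZero (den b)
den≢0 b = m*n≢0 (2 ^ b) (suc (2 * b) !!) {{m^n≢0 2 b}} {{n!!≢0 (suc (2 * b))}}

den-suc : ∀ b → den (suc b) ≡ 2 * (3 + 2 * b) * den b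
den-suc b = begin
  2 ^ suc b * suc (2 * suc b) !!            ≡⟨ cong (λ x → 2 ^ suc b * suc x !!) (2*[1+n]≡2+2*n b) ⟩
  2 * 2 ^ b * ((3 + 2 * b) * suc (2 * b) !!) ≡⟨ rearrange (2 ^ b) (suc (2 * b) !!) b ⟩
  2 * (3 + 2 * b) * den b                    ∎
  where
  open ≡-Reasoning
  rearrange : ∀ p d b → 2 * p * ((3 + 2 * b) * d) ≡ 2 * (3 + 2 * b) * (p * d)
  rearrange = solve-∀ ℕ-ring

b!*den[b]≡[1+2b]! : ∀ b → b ! * den b ≡ suc (2 * b) !
b!*den[b]≡[1+2b]! zero    = refl
b!*den[b]≡[1+2b]! (suc b) = begin
  suc b ! * den (suc b)                           ≡⟨ cong (suc b ! *_) (den-suc b) ⟩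
  suc b * b ! * (2 * (3 + 2 * b) * den b)         ≡⟨ rearrange b (b !) (den b) ⟩
  (3 + 2 * b) * ((2 + 2 * b) * (b ! * den b))     ≡⟨ cong (λ x → (3 + 2 * b) * ((2 + 2 * b) * x)) (b!*den[b]≡[1+2b]! b) ⟩
  suc (suc (suc (2 * b))) !                       ≡⟨ cong (λ x → suc x !) (2*[1+n]≡2+2*n b) ⟨
  suc (2 * suc b) !                               ∎
  where
  open ≡-Reasoning
  rearrange : ∀ b f d → suc b * f * (2 * (3 + 2 * b) * d) ≡ (3 + 2 * b) * ((2 + 2 * b) * (f * d))
  rearrange = solve-∀ ℕ-ring

C*!*!≡! : ∀ {m} i j → i + j ≡ m → (m C i) * (i ! * j !) ≡ m !
C*!*!≡! i j refl = begin
  ((i + j) C i) * (i ! * j !)                    ≡⟨ cong (λ x → ((i + j) C i) * (i ! * x !)) (m+n∸m≡n i j) ⟨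
  ((i + j) C i) * (i ! * (i + j ∸ i) !)          ≡⟨ cong (_* (i ! * (i + j ∸ i) !)) (nCk≡n!/k![n-k]! (m≤m+n i j)) ⟩
  (i + j) ! / (i ! * (i + j ∸ i) !) * (i ! * (i + j ∸ i) !) ≡⟨ m/n*n≡m (k![n∸k]!∣n! (m≤m+n i j)) ⟩
  (i + j) !                                    ∎
  where
  open ≡-Reasoning
  instance _ = i !* (i + j ∸ i) !≢0

C≢0 : ∀ {m} i j → i + j ≡ m → NonZero (m C i)
C≢0 {m} i j eq = m*n≢0⇒m≢0 (m C i) {{subst NonZero (sym (C*!*!≡! i j eq)) (m !≢0)}}

C-absorb : ∀ {m} i p → i + suc p ≡ m → (m C i) * suc p ≡ (m C suc i) * suc i
C-absorb {m} i p eq = *-cancelʳ-≡ ((m C i) * suc p) ((m C suc i) * suc i) (i ! * p !) {{i !* p !≢0}} (begin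
  (m C i) * suc p * (i ! * p !)            ≡⟨ rearrangeˡ (m C i) (suc p) (i !) (p !) ⟩
  (m C i) * (i ! * suc p !)                ≡⟨ C*!*!≡! i (suc p) eq ⟩
  m !                                    ≡⟨ C*!*!≡! (suc i) p (trans (sym (+-suc i p)) eq) ⟨
  (m C suc i) * (suc i ! * p !)            ≡⟨ rearrangeʳ (m C suc i) (suc i) (i !) (p !) ⟩
  (m C suc i) * suc i * (i ! * p !)        ∎)
  where
  open ≡-Reasoning
  rearrangeˡ : ∀ c q f g → c * q * (f * g) ≡ c * (f * (q * g))
  rearrangeˡ = solve-∀ ℕ-ring
  rearrangeʳ : ∀ c q f g → c * (q * f * g) ≡ c * q * (f * g)
  rearrangeʳ = solve-∀ ℕ-ring

-- Halves and parities

2*n/2≡n : ∀ n → 2 * n / 2 ≡ n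
2*n/2≡n n = trans (cong (_/ 2) (*-comm 2 n)) (m*n/n≡m n 2)

[1+2n]/2≡n : ∀ n → suc (2 * n) / 2 ≡ n
[1+2n]/2≡n zero    = refl
[1+2n]/2≡n (suc n) = begin
  suc (2 * suc n) / 2          ≡⟨ cong (λ x → suc x / 2) (2*[1+n]≡2+2*n n) ⟩
  suc (suc (suc (2 * n))) / 2  ≡⟨ m/n≡1+[m∸n]/n {suc (suc (suc (2 * n)))} (s≤s (s≤s z≤n)) ⟩
  suc (suc (2 * n) / 2)        ≡⟨ cong suc ([1+2n]/2≡n n) ⟩
  suc n                        ∎
  where open ≡-Reasoning

[2+2n]/2≡1+n : ∀ n → suc (suc (2 * n)) / 2 ≡ suc n
[2+2n]/2≡1+n n = trans (cong (_/ 2) (sym (2*[1+n]≡2+2*n n))) (2*n/2≡n (suc n))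

[1+2n]%2≡1 : ∀ n → suc (2 * n) % 2 ≡ 1
[1+2n]%2≡1 n = trans (cong (λ x → suc x % 2) (*-comm 2 n)) ([m+kn]%n≡m%n 1 n 2)

[2+2n]%2≡0 : ∀ n → suc (suc (2 * n)) % 2 ≡ 0
[2+2n]%2≡0 n = trans (cong (λ x → suc (suc x) % 2) (*-comm 2 n)) ([m+kn]%n≡m%n 2 n 2)

even-or-odd : ∀ n → (Σ[ h ∈ ℕ ] n ≡ 2 * h) ⊎ (Σ[ h ∈ ℕ ] n ≡ suc (2 * h))
even-or-odd zero = inj₁ (0 , refl)
even-or-odd (suc n) with even-or-odd n
... | inj₁ (h , refl) = inj₂ (h , refl)
... | inj₂ (h , refl) = inj₁ (suc h , sym (2*[1+n]≡2+2*n h))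

-- Used instead of a with-clause on the parity of n: with-abstracting the large goals
-- below makes Agda unfold the rational normalisation hidden in ⟦_⟧ and inv.
parity-cases : ∀ (Q : ℕ → Set) → (∀ h → Q (suc (2 * h))) → (∀ h → Q (suc (suc (2 * h)))) →
  ∀ n → 1 ≤ n → Q n
parity-cases Q odd even (suc m) _ with even-or-odd m
... | inj₁ (h , refl) = odd h
... | inj₂ (h , refl) = even h

-- The sums T

sum-map-*ˡ : ∀ c (f : ℕ → ℕ) xs → sum (map (λ x → c * f x) xs) ≡ c * sum (map f xs)
sum-map-*ˡ c f []       = sym (*-zeroʳ c)
sum-map-*ˡ c f (x ∷ xs) = begin
  c * f x + sum (map (λ x → c * f x) xs) ≡⟨ cong ((c * f x) +_) (sum-map-*ˡ c f xs) ⟩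
  c * f x + c * sum (map f xs)           ≡⟨ *-distribˡ-+ c (f x) (sum (map f xs)) ⟨
  c * (f x + sum (map f xs))             ∎
  where open ≡-Reasoning

n+2*[1+j]≡2+n+2*j : ∀ n j → n + 2 * suc j ≡ suc (suc (n + 2 * j))
n+2*[1+j]≡2+n+2*j = solve-∀ ℕ-ring

T-term : ℕ → ℕ → ℕ → ℕ
T-term n k i = 2 ^ i * ((n + 2 * k ∸ suc i ∸ 1) C (k ∸ 1))

T-suc : ∀ n j → T (suc n) (suc j) ≡ 2 * T n (suc j) + suc (n + 2 * j) C j
T-suc n j = begin
  T-term (suc n) k 0 + sum (map (T-term (suc n) k) (applyUpTo suc n))
    ≡⟨ cong₂ _+_ (trans (*-identityˡ _) (cong (_C j) first-index)) (cong sum shift) ⟩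
  m C j + sum (map (λ i → 2 * T-term n k i) (upTo n))
    ≡⟨ cong (m C j +_) (sum-map-*ˡ 2 (T-term n k) (upTo n)) ⟩
  m C j + 2 * T n k
    ≡⟨ +-comm (m C j) (2 * T n k) ⟩
  2 * T n k + m C j ∎
  where
  open ≡-Reasoning
  k = suc j
  m = suc (n + 2 * j)
  first-index : suc n + 2 * k ∸ 1 ∸ 1 ≡ m
  first-index = cong (_∸ 1) (n+2*[1+j]≡2+n+2*j n j)
  shift : map (T-term (suc n) k) (applyUpTo suc n) ≡ map (λ i → 2 * T-term n k i) (upTo n)
  shift = begin
    map (T-term (suc n) k) (applyUpTo suc n)    ≡⟨ map-applyUpTo suc (T-term (suc n) k) n ⟩
    applyUpTo (T-term (suc n) k ∘ suc) n        ≡⟨ map-upTo (T-term (suc n) k ∘ suc) n ⟨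
    map (T-term (suc n) k ∘ suc) (upTo n)       ≡⟨ map-cong (λ i → *-assoc 2 (2 ^ i) _) (upTo n) ⟩
    map (λ i → 2 * T-term n k i) (upTo n)       ∎

T-shift : ∀ n j → let m = suc (n + 2 * j) in
  T n (suc (suc j)) + m C suc j ≡ 4 * T n (suc j) + m C j
T-shift zero j = begin
  suc (2 * j) C suc j                 ≡⟨ nCk≡nC[n∸k] (s≤s (m≤m+n j (j + 0))) ⟩
  suc (2 * j) C (j + (j + 0) ∸ j)     ≡⟨ cong (suc (2 * j) C_) (trans (m+n∸m≡n j (j + 0)) (+-identityʳ j)) ⟩
  suc (2 * j) C j                     ∎
  where open ≡-Reasoning
T-shift (suc n) j = begin
  T (suc n) (suc (suc j)) + suc m C suc j
    ≡⟨ cong (_+ suc m C suc j) (T-suc n (suc j)) ⟩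
  2 * T n (suc (suc j)) + suc (n + 2 * suc j) C suc j + suc m C suc j
    ≡⟨ cong (λ x → 2 * T n (suc (suc j)) + suc x C suc j + suc m C suc j) (n+2*[1+j]≡2+n+2*j n j) ⟩
  2 * T n (suc (suc j)) + suc (suc m) C suc j + suc m C suc j
    ≡⟨ arith (T n (suc (suc j))) (T n (suc j)) (m C j) (m C suc j) (suc m C j)
         (T-shift n j) (nCk+nC[k+1]≡[n+1]C[k+1] m j) (nCk+nC[k+1]≡[n+1]C[k+1] (suc m) j) ⟩
  4 * (2 * T n (suc j) + m C j) + suc m C j
    ≡⟨ cong (λ x → 4 * x + suc m C j) (T-suc n j) ⟨
  4 * T (suc n) (suc j) + suc m C j ∎
  where
  open ≡-Reasoning
  m = suc (n + 2 * j)
  arith : ∀ t₂ t₁ a b c {d e} → t₂ + b ≡ 4 * t₁ + a → a + b ≡ d → c + d ≡ e →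
    2 * t₂ + e + d ≡ 4 * (2 * t₁ + a) + c
  arith t₂ t₁ a b c eq refl refl = begin
    2 * t₂ + (c + (a + b)) + (a + b) ≡⟨ solve (t₂ ∷ a ∷ b ∷ c ∷ []) ℕ-ring ⟩
    2 * (t₂ + b) + c + 2 * a         ≡⟨ cong (λ x → 2 * x + c + 2 * a) eq ⟩
    2 * (4 * t₁ + a) + c + 2 * a     ≡⟨ solve (t₁ ∷ a ∷ c ∷ []) ℕ-ring ⟩
    4 * (2 * t₁ + a) + c             ∎

T-step : ∀ n j → let k = suc j; q = n + k; m = suc (n + 2 * j) in
  4 * q * T n k + q * T n (suc k) + (q + 3 * k) * (m C k) ≡ 4 * q * T (suc n) k
T-step n j = key q k (T n k) (T n (suc k)) (T-shift n j) (T-suc n j) absorb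
  where
  open ≡-Reasoning
  k = suc j
  q = n + k
  m = suc (n + 2 * j)
  m-split : j + suc (n + j) ≡ suc (n + 2 * j)
  m-split = solve (n ∷ j ∷ []) ℕ-ring
  absorb : q * (m C j) ≡ k * (m C k)
  absorb = begin
    q * (m C j)             ≡⟨ cong (_* (m C j)) (+-suc n j) ⟩
    suc (n + j) * (m C j)   ≡⟨ *-comm (suc (n + j)) (m C j) ⟩
    (m C j) * suc (n + j)   ≡⟨ C-absorb j (n + j) m-split ⟩
    (m C k) * k             ≡⟨ *-comm (m C k) k ⟩
    k * (m C k)             ∎
  key : ∀ q k t₁ t₂ {a b w} → t₂ + b ≡ 4 * t₁ + a → w ≡ 2 * t₁ + a → q * a ≡ k * b →
    4 * q * t₁ + q * t₂ + (q + 3 * k) * b ≡ 4 * q * w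
  key q k t₁ t₂ {a} {b} shift refl qa≡kb = begin
    4 * q * t₁ + q * t₂ + (q + 3 * k) * b     ≡⟨ solve (q ∷ k ∷ t₁ ∷ t₂ ∷ b ∷ []) ℕ-ring ⟩
    4 * q * t₁ + q * (t₂ + b) + 3 * (k * b)   ≡⟨ cong₂ (λ x y → 4 * q * t₁ + q * x + 3 * y) shift (sym qa≡kb) ⟩
    4 * q * t₁ + q * (4 * t₁ + a) + 3 * (q * a) ≡⟨ solve (q ∷ t₁ ∷ a ∷ []) ℕ-ring ⟩
    4 * q * (2 * t₁ + a)                       ∎

-- The closed form

frac-den-suc : ∀ p b → frac p (den b) ≡ frac (2 * (3 + 2 * b) * p) (den (suc b))
frac-den-suc p b = frac-cross p (2 * (3 + 2 * b) * p) (den b) (den (suc b)) {{den≢0 b}} {{den≢0 (suc b)}} (begin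
  p * den (suc b)                   ≡⟨ cong (p *_) (den-suc b) ⟩
  p * (2 * (3 + 2 * b) * den b)     ≡⟨ *-assoc p _ (den b) ⟨
  p * (2 * (3 + 2 * b)) * den b     ≡⟨ cong (_* den b) (*-comm p _) ⟩
  2 * (3 + 2 * b) * p * den b       ∎)
  where open ≡-Reasoning

rising-factorial : ∀ k h → ⟦ k ! ⟧ ℚ.* foldr ℚ._*_ 1ℚ (map (λ i → ⟦ k + suc i ⟧) (upTo h)) ≡ ⟦ (k + h) ! ⟧
rising-factorial k zero    = trans (ℚ.*-identityʳ ⟦ k ! ⟧) (cong (λ x → ⟦ x ! ⟧) (sym (+-identityʳ k)))
rising-factorial k (suc h) = begin
  ⟦ k ! ⟧ ℚ.* (⟦ k + 1 ⟧ ℚ.* ∏ (map (λ i → ⟦ k + suc i ⟧) (applyUpTo suc h)))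
    ≡⟨ cong₂ (λ x y → ⟦ k ! ⟧ ℚ.* (⟦ x ⟧ ℚ.* ∏ y)) (+-comm k 1) shift ⟩
  ⟦ k ! ⟧ ℚ.* (⟦ suc k ⟧ ℚ.* ∏ (map (λ i → ⟦ suc k + suc i ⟧) (upTo h)))
    ≡⟨ ℚ.*-assoc ⟦ k ! ⟧ ⟦ suc k ⟧ _ ⟨
  ⟦ k ! ⟧ ℚ.* ⟦ suc k ⟧ ℚ.* ∏ (map (λ i → ⟦ suc k + suc i ⟧) (upTo h))
    ≡⟨ cong (ℚ._* ∏ (map (λ i → ⟦ suc k + suc i ⟧) (upTo h))) (trans (ℚ.*-comm ⟦ k ! ⟧ ⟦ suc k ⟧) (sym (⟦⟧-homo-* (suc k) (k !)))) ⟩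
  ⟦ suc k ! ⟧ ℚ.* ∏ (map (λ i → ⟦ suc k + suc i ⟧) (upTo h))
    ≡⟨ rising-factorial (suc k) h ⟩
  ⟦ (suc k + h) ! ⟧
    ≡⟨ cong (λ x → ⟦ x ! ⟧) (+-suc k h) ⟨
  ⟦ (k + suc h) ! ⟧ ∎
  where
  open ≡-Reasoning
  ∏ : List ℚ → ℚ
  ∏ = foldr ℚ._*_ 1ℚ
  shift : map (λ i → ⟦ k + suc i ⟧) (applyUpTo suc h) ≡ map (λ i → ⟦ suc k + suc i ⟧) (upTo h)
  shift = begin
    map (λ i → ⟦ k + suc i ⟧) (applyUpTo suc h)   ≡⟨ map-applyUpTo suc _ h ⟩
    applyUpTo (λ i → ⟦ k + suc (suc i) ⟧) h       ≡⟨ map-upTo _ h ⟨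
    map (λ i → ⟦ k + suc (suc i) ⟧) (upTo h)      ≡⟨ map-cong (λ i → cong ⟦_⟧ (+-suc k (suc i))) (upTo h) ⟩
    map (λ i → ⟦ suc k + suc i ⟧) (upTo h)        ∎

ℓ-odd : ∀ h k → ℓ (suc (2 * h)) k ≡ frac ((k + h) !) (k !)
ℓ-odd h k = *-cancelˡ-⟦⟧ (k !) {{k !≢0}} (begin
  ⟦ k ! ⟧ ℚ.* ℓ (suc (2 * h)) k   ≡⟨ cong (λ x → ⟦ k ! ⟧ ℚ.* foldr ℚ._*_ 1ℚ (map (λ i → ⟦ k + suc i ⟧) (upTo x))) (2*n/2≡n h) ⟩
  ⟦ k ! ⟧ ℚ.* foldr ℚ._*_ 1ℚ (map (λ i → ⟦ k + suc i ⟧) (upTo h)) ≡⟨ rising-factorial k h ⟩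
  ⟦ (k + h) ! ⟧                  ≡⟨ ⟦⟧*frac ((k + h) !) (k !) {{k !≢0}} ⟨
  ⟦ k ! ⟧ ℚ.* frac ((k + h) !) (k !) ∎)
  where open ≡-Reasoning

ℓ-as-frac-odd : ∀ h j → let k = suc j; a = suc (2 * h) + j; b = h + j; m = suc (suc (2 * h) + 2 * j) in
  ℓ (suc (2 * h)) k ≡ frac ((3 + 2 * b) * ((m C k) * a !)) (den (suc b))
ℓ-as-frac-odd h j = trans (ℓ-odd h k) (frac-cross ((k + h) !) (s * ((m C k) * a !)) (k !) (den (suc b)) {{k !≢0}} {{den≢0 (suc b)}} (begin
  (k + h) ! * den (suc b)        ≡⟨ cong (λ v → v ! * den (suc b)) (cong suc (+-comm j h)) ⟩
  suc b ! * den (suc b)          ≡⟨ b!*den[b]≡[1+2b]! (suc b) ⟩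
  suc (2 * suc b) !              ≡⟨ cong (λ v → suc v !) (2*[1+n]≡2+2*n b) ⟩
  s * suc (suc (2 * b)) !        ≡⟨ cong (λ v → s * v !) m-split ⟩
  s * m !                        ≡⟨ cong (s *_) (C*!*!≡! k a m-split′) ⟨
  s * ((m C k) * (k ! * a !))    ≡⟨ rearrange s (m C k) (k !) (a !) ⟩
  s * ((m C k) * a !) * k !      ∎))
  where
  open ≡-Reasoning
  k = suc j
  a = suc (2 * h) + j
  b = h + j
  s = 3 + 2 * b
  m = suc (suc (2 * h) + 2 * j)
  m-split : suc (suc (2 * (h + j))) ≡ suc (suc (2 * h) + 2 * j)
  m-split = solve (h ∷ j ∷ []) ℕ-ring
  m-split′ : suc j + (suc (2 * h) + j) ≡ suc (suc (2 * h) + 2 * j)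
  m-split′ = solve (h ∷ j ∷ []) ℕ-ring
  rearrange : ∀ s c f g → s * (c * (f * g)) ≡ s * (c * g) * f
  rearrange = solve-∀ ℕ-ring

ℓ-as-frac-even : ∀ h j → let k = suc j; a = suc (suc (2 * h)) + j; b = suc (h + j); m = suc (suc (suc (2 * h)) + 2 * j) in
  ℓ (suc (2 * h)) k ≡ frac (2 * (3 + 2 * b) * ((m C k) * a !)) (den (suc b))
ℓ-as-frac-even h j = trans (ℓ-odd h k) (frac-cross ((k + h) !) (2 * s * ((m C k) * a !)) (k !) (den (suc b)) {{k !≢0}} {{den≢0 (suc b)}} (begin
  (k + h) ! * den (suc b)        ≡⟨ cong₂ (λ v w → v ! * w) (cong suc (+-comm j h)) (den-suc b) ⟩
  b ! * (2 * s * den b)          ≡⟨ rearrangeˡ (b !) (2 * s) (den b) ⟩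
  2 * s * (b ! * den b)          ≡⟨ cong (2 * s *_) (b!*den[b]≡[1+2b]! b) ⟩
  2 * s * suc (2 * b) !          ≡⟨ cong (λ v → 2 * s * v !) m-split ⟩
  2 * s * m !                    ≡⟨ cong (2 * s *_) (C*!*!≡! k a m-split′) ⟨
  2 * s * ((m C k) * (k ! * a !)) ≡⟨ rearrangeʳ (2 * s) (m C k) (k !) (a !) ⟩
  2 * s * ((m C k) * a !) * k !  ∎))
  where
  open ≡-Reasoning
  k = suc j
  a = suc (suc (2 * h)) + j
  b = suc (h + j)
  s = 3 + 2 * b
  m = suc (suc (suc (2 * h)) + 2 * j)
  m-split : suc (2 * suc (h + j)) ≡ suc (suc (suc (2 * h)) + 2 * j)
  m-split = solve (h ∷ j ∷ []) ℕ-ring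
  m-split′ : suc j + (suc (suc (2 * h)) + j) ≡ suc (suc (suc (2 * h)) + 2 * j)
  m-split′ = solve (h ∷ j ∷ []) ℕ-ring
  rearrangeˡ : ∀ f c d → f * (c * d) ≡ c * (f * d)
  rearrangeˡ = solve-∀ ℕ-ring
  rearrangeʳ : ∀ s c f g → s * (c * (f * g)) ≡ s * (c * g) * f
  rearrangeʳ = solve-∀ ℕ-ring

step-odd : ∀ n f k → n % 2 ≡ 1 →
  step n f k ≡ inv (4 * (2 * k + n)) ℚ.*
    (⟦ 2 * (k + n) ⟧ ℚ.* f k ℚ.+ ⟦ 2 * k + n ⟧ ℚ.* f (suc k) ℚ.+ ⟦ 4 * k + n ⟧ ℚ.* ℓ n k)
step-odd n f k n%2≡1 with n % 2
step-odd n f k refl | .1 = refl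

step-even : ∀ n f k → n % 2 ≡ 0 →
  step n f k ≡ inv 4 ℚ.*
    (⟦ 4 * (k + n) ⟧ ℚ.* f k ℚ.+ ⟦ 2 * (2 * k + n + 1) ⟧ ℚ.* f (suc k) ℚ.+ ⟦ 4 * k + n ⟧ ℚ.* ℓ (n ∸ 1) k)
step-even n f k n%2≡0 with n % 2
step-even n f k refl | .0 = refl

odd-step-numerator : ∀ h j t₁ t₂ c f w →
  let n = suc (2 * h); k = suc j; q = n + k; s = 3 + 2 * (h + j) in
  4 * q * t₁ + q * t₂ + (q + 3 * k) * c ≡ 4 * q * w →
  2 * (k + n) * (2 * s * (t₁ * f)) + (2 * k + n) * (t₂ * (suc (n + j) * f)) + (4 * k + n) * (s * (c * f))
    ≡ w * (suc (n + j) * f) * (4 * (2 * k + n))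
odd-step-numerator h j t₁ t₂ c f w hyp =
  let n = suc (2 * h); k = suc j; q = n + k; s = 3 + 2 * (h + j) in
  begin
  2 * (k + n) * (2 * s * (t₁ * f)) + (2 * k + n) * (t₂ * (suc (n + j) * f)) + (4 * k + n) * (s * (c * f))
    ≡⟨ solve (h ∷ j ∷ t₁ ∷ t₂ ∷ c ∷ f ∷ []) ℕ-ring ⟩
  s * f * (4 * q * t₁ + q * t₂ + (q + 3 * k) * c)
    ≡⟨ cong (s * f *_) hyp ⟩
  s * f * (4 * q * w)
    ≡⟨ solve (h ∷ j ∷ f ∷ w ∷ []) ℕ-ring ⟩
  w * (suc (n + j) * f) * (4 * (2 * k + n)) ∎
  where open ≡-Reasoning

-- The second argument is ⌊n/2⌋, and j = k − 1.
ClosedForm : ℕ → ℕ → Set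
ClosedForm n b = ∀ j → P n (suc j) ≡ frac (T n (suc j) * (n + j) !) (den (b + j))

step-from-odd : ∀ h → ClosedForm (suc (2 * h)) h → ∀ j →
  step (suc (2 * h)) (P (suc (2 * h))) (suc j)
    ≡ frac (T (suc (suc (2 * h))) (suc j) * (suc (suc (2 * h)) + j) !) (den (suc h + j))
step-from-odd h closed j = begin
  step n (P n) k
    ≡⟨ step-odd n (P n) k ([1+2n]%2≡1 h) ⟩
  inv e ℚ.* (⟦ c₁ ⟧ ℚ.* P n k ℚ.+ ⟦ c₂ ⟧ ℚ.* P n (suc k) ℚ.+ ⟦ c₃ ⟧ ℚ.* ℓ n k)
    ≡⟨ cong₂ (λ u v → inv e ℚ.* (u ℚ.+ v)) (cong₂ (λ x y → ⟦ c₁ ⟧ ℚ.* x ℚ.+ ⟦ c₂ ⟧ ℚ.* y) Pₙₖ Pₙₖ₊₁) (cong (⟦ c₃ ⟧ ℚ.*_) ℓₙₖ) ⟩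
  inv e ℚ.* (⟦ c₁ ⟧ ℚ.* frac x U ℚ.+ ⟦ c₂ ⟧ ℚ.* frac y U ℚ.+ ⟦ c₃ ⟧ ℚ.* frac z U)
    ≡⟨ inv*-frac-sum e U c₁ c₂ c₃ x y z {{_}} {{den≢0 (suc b)}} ⟩
  frac (c₁ * x + c₂ * y + c₃ * z) (e * U)
    ≡⟨ frac-cross (c₁ * x + c₂ * y + c₃ * z) (T (suc n) k * (suc a * a !)) (e * U) U {{m*n≢0 e U {{_}} {{den≢0 (suc b)}}}} {{den≢0 (suc b)}} cross ⟩
  frac (T (suc n) k * (suc a * a !)) U ∎
  where
  open ≡-Reasoning
  n = suc (2 * h)
  k = suc j
  a = n + j
  b = h + j
  s = 3 + 2 * b
  U = den (suc b)
  m = suc (n + 2 * j)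
  e = 4 * (2 * k + n)
  c₁ = 2 * (k + n)
  c₂ = 2 * k + n
  c₃ = 4 * k + n
  x = 2 * s * (T n k * a !)
  y = T n (suc k) * (suc a * a !)
  z = s * ((m C k) * a !)
  Pₙₖ : P n k ≡ frac x U
  Pₙₖ = trans (closed j) (frac-den-suc (T n k * a !) b)
  Pₙₖ₊₁ : P n (suc k) ≡ frac y U
  Pₙₖ₊₁ = trans (closed k) (cong₂ (λ u v → frac (T n (suc k) * u !) (den v)) (+-suc n j) (+-suc h j))
  ℓₙₖ : ℓ n k ≡ frac z U
  ℓₙₖ = ℓ-as-frac-odd h j
  cross : (c₁ * x + c₂ * y + c₃ * z) * U ≡ T (suc n) k * (suc a * a !) * (e * U)
  cross = begin
    (c₁ * x + c₂ * y + c₃ * z) * U                 ≡⟨ cong (_* U) (odd-step-numerator h j (T n k) (T n (suc k)) (m C k) (a !) (T (suc n) k) (T-step n j)) ⟩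
    T (suc n) k * (suc a * a !) * e * U            ≡⟨ *-assoc (T (suc n) k * (suc a * a !)) e U ⟩
    T (suc n) k * (suc a * a !) * (e * U)          ∎

even-step-numerator : ∀ h j t₁ t₂ c f w →
  let n = suc (suc (2 * h)); k = suc j; q = n + k; s = 3 + 2 * suc (h + j) in
  4 * q * t₁ + q * t₂ + (q + 3 * k) * c ≡ 4 * q * w →
  4 * (k + n) * (2 * s * (t₁ * f)) + 2 * (2 * k + n + 1) * (t₂ * (suc (n + j) * f)) + (4 * k + n) * (2 * s * (c * f))
    ≡ w * (suc (n + j) * f) * (4 * (2 * s))
even-step-numerator h j t₁ t₂ c f w hyp =
  let n = suc (suc (2 * h)); k = suc j; q = n + k; s = 3 + 2 * suc (h + j) in
  begin
  4 * (k + n) * (2 * s * (t₁ * f)) + 2 * (2 * k + n + 1) * (t₂ * (suc (n + j) * f)) + (4 * k + n) * (2 * s * (c * f))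
    ≡⟨ solve (h ∷ j ∷ t₁ ∷ t₂ ∷ c ∷ f ∷ []) ℕ-ring ⟩
  2 * s * f * (4 * q * t₁ + q * t₂ + (q + 3 * k) * c)
    ≡⟨ cong (2 * s * f *_) hyp ⟩
  2 * s * f * (4 * q * w)
    ≡⟨ solve (h ∷ j ∷ f ∷ w ∷ []) ℕ-ring ⟩
  w * (suc (n + j) * f) * (4 * (2 * s)) ∎
  where open ≡-Reasoning

step-from-even : ∀ h → ClosedForm (suc (suc (2 * h))) (suc h) → ClosedForm (suc (suc (suc (2 * h)))) (suc h)
step-from-even h closed j = begin
  step n (P n) k
    ≡⟨ step-even n (P n) k ([2+2n]%2≡0 h) ⟩
  inv 4 ℚ.* (⟦ c₁ ⟧ ℚ.* P n k ℚ.+ ⟦ c₂ ⟧ ℚ.* P n (suc k) ℚ.+ ⟦ c₃ ⟧ ℚ.* ℓ (n ∸ 1) k)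
    ≡⟨ cong₂ (λ u v → inv 4 ℚ.* (u ℚ.+ v)) (cong₂ (λ x y → ⟦ c₁ ⟧ ℚ.* x ℚ.+ ⟦ c₂ ⟧ ℚ.* y) Pₙₖ Pₙₖ₊₁) (cong (⟦ c₃ ⟧ ℚ.*_) ℓₙₖ) ⟩
  inv 4 ℚ.* (⟦ c₁ ⟧ ℚ.* frac x U ℚ.+ ⟦ c₂ ⟧ ℚ.* frac y U ℚ.+ ⟦ c₃ ⟧ ℚ.* frac z U)
    ≡⟨ inv*-frac-sum 4 U c₁ c₂ c₃ x y z {{_}} {{den≢0 (suc b)}} ⟩
  frac (c₁ * x + c₂ * y + c₃ * z) (4 * U)
    ≡⟨ frac-cross (c₁ * x + c₂ * y + c₃ * z) (T (suc n) k * (suc a * a !)) (4 * U) (den b)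
         {{m*n≢0 4 U {{_}} {{den≢0 (suc b)}}}} {{den≢0 b}} cross ⟩
  frac (T (suc n) k * (suc a * a !)) (den b) ∎
  where
  open ≡-Reasoning
  n = suc (suc (2 * h))
  k = suc j
  a = n + j
  b = suc (h + j)
  s = 3 + 2 * b
  U = den (suc b)
  m = suc (n + 2 * j)
  c₁ = 4 * (k + n)
  c₂ = 2 * (2 * k + n + 1)
  c₃ = 4 * k + n
  x = 2 * s * (T n k * a !)
  y = T n (suc k) * (suc a * a !)
  z = 2 * s * ((m C k) * a !)
  Pₙₖ : P n k ≡ frac x U
  Pₙₖ = trans (closed j) (frac-den-suc (T n k * a !) b)
  Pₙₖ₊₁ : P n (suc k) ≡ frac y U
  Pₙₖ₊₁ = trans (closed k) (cong₂ (λ u v → frac (T n (suc k) * u !) (den v)) (+-suc n j) (cong suc (+-suc h j)))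
  ℓₙₖ : ℓ (n ∸ 1) k ≡ frac z U
  ℓₙₖ = ℓ-as-frac-even h j
  cross : (c₁ * x + c₂ * y + c₃ * z) * den b ≡ T (suc n) k * (suc a * a !) * (4 * U)
  cross = begin
    (c₁ * x + c₂ * y + c₃ * z) * den b
      ≡⟨ cong (_* den b) (even-step-numerator h j (T n k) (T n (suc k)) (m C k) (a !) (T (suc n) k) (T-step n j)) ⟩
    T (suc n) k * (suc a * a !) * (4 * (2 * s)) * den b
      ≡⟨ rearrange (T (suc n) k * (suc a * a !)) (2 * s) (den b) ⟩
    T (suc n) k * (suc a * a !) * (4 * (2 * s * den b))
      ≡⟨ cong (λ v → T (suc n) k * (suc a * a !) * (4 * v)) (den-suc b) ⟨
    T (suc n) k * (suc a * a !) * (4 * U) ∎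
    where
    rearrange : ∀ w c d → w * (4 * c) * d ≡ w * (4 * (c * d))
    rearrange = solve-∀ ℕ-ring

closed-form-one : ClosedForm 1 0
closed-form-one j = trans (sym frac-1-1) (frac-cross 1 (T 1 (suc j) * suc j !) 1 (den j) {{_}} {{den≢0 j}}
  (*-cancelʳ-≡ (1 * den j) (T 1 (suc j) * suc j ! * 1) (j !) {{j !≢0}} (begin
    1 * den j * j !                                  ≡⟨ rearrangeˡ (den j) (j !) ⟩
    j ! * den j                                      ≡⟨ b!*den[b]≡[1+2b]! j ⟩
    suc (2 * j) !                                    ≡⟨ C*!*!≡! j (suc j) (solve (j ∷ []) ℕ-ring) ⟨
    (suc (2 * j) C j) * (j ! * suc j !)              ≡⟨ rearrangeʳ (suc (2 * j) C j) (j !) (suc j !) ⟩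
    (suc (2 * j) C j) * suc j ! * 1 * j !            ≡⟨ cong (λ t → t * suc j ! * 1 * j !) (T-suc 0 j) ⟨
    T 1 (suc j) * suc j ! * 1 * j !                  ∎)))
  where
  open ≡-Reasoning
  rearrangeˡ : ∀ d f → 1 * d * f ≡ f * d
  rearrangeˡ = solve-∀ ℕ-ring
  rearrangeʳ : ∀ c f g → c * (f * g) ≡ c * g * 1 * f
  rearrangeʳ = solve-∀ ℕ-ring

-- P₂ = 1 also obeys the odd recurrence at n = 1, so the base of the even case is a step too.
P₂≡step : ∀ k → P 2 k ≡ step 1 (P 1) k
P₂≡step k = sym (begin
  step 1 (P 1) k
    ≡⟨ step-odd 1 (P 1) k refl ⟩
  inv e ℚ.* (⟦ 2 * (k + 1) ⟧ ℚ.* 1ℚ ℚ.+ ⟦ 2 * k + 1 ⟧ ℚ.* 1ℚ ℚ.+ ⟦ 4 * k + 1 ⟧ ℚ.* 1ℚ)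
    ≡⟨ cong (λ o → inv e ℚ.* (⟦ 2 * (k + 1) ⟧ ℚ.* o ℚ.+ ⟦ 2 * k + 1 ⟧ ℚ.* o ℚ.+ ⟦ 4 * k + 1 ⟧ ℚ.* o)) (sym frac-1-1) ⟩
  inv e ℚ.* (⟦ 2 * (k + 1) ⟧ ℚ.* frac 1 1 ℚ.+ ⟦ 2 * k + 1 ⟧ ℚ.* frac 1 1 ℚ.+ ⟦ 4 * k + 1 ⟧ ℚ.* frac 1 1)
    ≡⟨ inv*-frac-sum e 1 (2 * (k + 1)) (2 * k + 1) (4 * k + 1) 1 1 1 {{e≢0}} ⟩
  frac (2 * (k + 1) * 1 + (2 * k + 1) * 1 + (4 * k + 1) * 1) (e * 1)
    ≡⟨ frac-cross (2 * (k + 1) * 1 + (2 * k + 1) * 1 + (4 * k + 1) * 1) 1 (e * 1) 1 {{m*n≢0 e 1 {{e≢0}}}} numerator ⟩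
  frac 1 1
    ≡⟨ frac-1-1 ⟩
  1ℚ ∎)
  where
  open ≡-Reasoning
  e = 4 * (2 * k + 1)
  e≢0 : NonZero e
  e≢0 = m*n≢0 4 (2 * k + 1) {{_}} {{≢-nonZero (m+1+n≢0 (2 * k))}}
  numerator : (2 * (k + 1) * 1 + (2 * k + 1) * 1 + (4 * k + 1) * 1) * 1 ≡ 1 * (4 * (2 * k + 1) * 1)
  numerator = solve (k ∷ []) ℕ-ring

closed-form-odd  : ∀ h → ClosedForm (suc (2 * h)) h
closed-form-even : ∀ h → ClosedForm (suc (suc (2 * h))) (suc h)

closed-form-odd zero    = closed-form-one
closed-form-odd (suc h) = subst (λ n → ClosedForm n (suc h)) (cong suc (sym (2*[1+n]≡2+2*n h)))
  (step-from-even h (closed-form-even h))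

closed-form-even zero j    = trans (P₂≡step (suc j)) (step-from-odd 0 (closed-form-odd 0) j)
closed-form-even (suc h) j = step-from-odd (suc h) (closed-form-odd (suc h)) j

closed-form : ∀ n → 1 ≤ n → ClosedForm n (n / 2)
closed-form = parity-cases (λ n → ClosedForm n (n / 2)) odd even
  where
  odd : ∀ h → ClosedForm (suc (2 * h)) (suc (2 * h) / 2)
  odd h = subst (ClosedForm (suc (2 * h))) (sym ([1+2n]/2≡n h)) (closed-form-odd h)
  even : ∀ h → ClosedForm (suc (suc (2 * h))) (suc (suc (2 * h)) / 2)
  even h = subst (ClosedForm (suc (suc (2 * h)))) (sym ([2+2n]/2≡1+n h)) (closed-form-even h)

-- The three forms of the theorem

frac-den-as-binomials : ∀ t i h a b x y z → i + h ≡ b → i + a ≡ suc (2 * b) →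
  x ≡ b → y ≡ suc (2 * b) → z ≡ h →
  frac (t * a !) (den b) ≡ ((⟦ x C i ⟧ ℚ.* inv (y C i)) ℚ.* ⟦ z ! ⟧) ℚ.* ⟦ t ⟧
frac-den-as-binomials t i h a b .b .(suc (2 * b)) .h i+h≡b i+a≡c refl refl refl = begin
  frac (t * a !) (den b)                                ≡⟨ frac-cross (t * a !) (B * h ! * t) (den b) (c C i) {{den≢0 b}} {{C≢0 i a i+a≡c}} cross ⟩
  frac (B * h ! * t) (c C i)                             ≡⟨ frac-def (B * h ! * t) (c C i) ⟩
  ⟦ B * h ! * t ⟧ ℚ.* inv (c C i)                        ≡⟨ cong (ℚ._* inv (c C i)) (trans (⟦⟧-homo-* (B * h !) t) (cong (ℚ._* ⟦ t ⟧) (⟦⟧-homo-* B (h !)))) ⟩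
  ⟦ B ⟧ ℚ.* ⟦ h ! ⟧ ℚ.* ⟦ t ⟧ ℚ.* inv (c C i)            ≡⟨ rearrange ⟦ B ⟧ ⟦ h ! ⟧ ⟦ t ⟧ (inv (c C i)) ⟩
  ⟦ B ⟧ ℚ.* inv (c C i) ℚ.* ⟦ h ! ⟧ ℚ.* ⟦ t ⟧            ∎
  where
  open ≡-Reasoning
  B = b C i
  c = suc (2 * b)
  rearrange : ∀ p q r s → p ℚ.* q ℚ.* r ℚ.* s ≡ p ℚ.* s ℚ.* q ℚ.* r
  rearrange = solve-∀ ℚ-ring
  cross : t * a ! * (c C i) ≡ B * h ! * t * den b
  cross = *-cancelʳ-≡ _ _ (i !) {{i !≢0}} (begin
    t * a ! * (c C i) * i !        ≡⟨ rearrangeˡ t (a !) (c C i) (i !) ⟩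
    t * ((c C i) * (i ! * a !))    ≡⟨ cong (t *_) (C*!*!≡! i a i+a≡c) ⟩
    t * c !                        ≡⟨ cong (t *_) (b!*den[b]≡[1+2b]! b) ⟨
    t * (b ! * den b)              ≡⟨ cong (λ x → t * (x * den b)) (C*!*!≡! i h i+h≡b) ⟨
    t * (B * (i ! * h !) * den b)  ≡⟨ rearrangeʳ t B (i !) (h !) (den b) ⟩
    B * h ! * t * den b * i !      ∎)
    where
    rearrangeˡ : ∀ t f c g → t * f * c * g ≡ t * (c * (g * f))
    rearrangeˡ = solve-∀ ℕ-ring
    rearrangeʳ : ∀ t c f g d → t * (c * (f * g) * d) ≡ c * g * t * d * f
    rearrangeʳ = solve-∀ ℕ-ring

frac-den-as-double-factorial : ∀ t a b x y z → x ≡ b → y ≡ a → z ≡ suc (2 * b) →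
  frac (t * a !) (den b) ≡ ((inv (2 ^ x) ℚ.* ⟦ y ! ⟧) ℚ.* inv (z !!)) ℚ.* ⟦ t ⟧
frac-den-as-double-factorial t a b .b .a .(suc (2 * b)) refl refl refl = begin
  frac (t * a !) (den b)                                     ≡⟨ frac-def (t * a !) (den b) ⟩
  ⟦ t * a ! ⟧ ℚ.* inv (den b)                                ≡⟨ cong₂ ℚ._*_ (⟦⟧-homo-* t (a !)) (inv-* (2 ^ b) (suc (2 * b) !!) {{m^n≢0 2 b}} {{n!!≢0 (suc (2 * b))}}) ⟩
  ⟦ t ⟧ ℚ.* ⟦ a ! ⟧ ℚ.* (inv (2 ^ b) ℚ.* inv (suc (2 * b) !!)) ≡⟨ rearrange ⟦ t ⟧ ⟦ a ! ⟧ (inv (2 ^ b)) (inv (suc (2 * b) !!)) ⟩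
  inv (2 ^ b) ℚ.* ⟦ a ! ⟧ ℚ.* inv (suc (2 * b) !!) ℚ.* ⟦ t ⟧  ∎
  where
  open ≡-Reasoning
  rearrange : ∀ p q r s → p ℚ.* q ℚ.* (r ℚ.* s) ≡ r ℚ.* q ℚ.* s ℚ.* p
  rearrange = solve-∀ ℚ-ring

OddBinomialForm : ℕ → ℕ → Set
OddBinomialForm n k = n % 2 ≡ 1 →
  P n k ≡ ((⟦ ((n ∸ 1) / 2 + k ∸ 1) C (k ∸ 1) ⟧ ℚ.* inv ((n + 2 * k ∸ 2) C (k ∸ 1)))
            ℚ.* ⟦ ((n ∸ 1) / 2) ! ⟧) ℚ.* ⟦ T n k ⟧

EvenBinomialForm : ℕ → ℕ → Set
EvenBinomialForm n k = n % 2 ≡ 0 →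
  P n k ≡ ((⟦ (n / 2 + k ∸ 1) C k ⟧ ℚ.* inv ((n + 2 * k ∸ 1) C k)) ℚ.* ⟦ (n / 2 ∸ 1) ! ⟧) ℚ.* ⟦ T n k ⟧

DoubleFactorialForm : ℕ → ℕ → Set
DoubleFactorialForm n k =
  P n k ≡ ((inv (2 ^ (n / 2 + k ∸ 1)) ℚ.* ⟦ (n + k ∸ 1) ! ⟧) ℚ.* inv ((2 * (n / 2) + 2 * k ∸ 1) !!)) ℚ.* ⟦ T n k ⟧

P-odd-binomial-form : ∀ n k → 1 ≤ n → 1 ≤ k → OddBinomialForm n k
P-odd-binomial-form n (suc j) n≥1 _ = parity-cases (λ n → OddBinomialForm n (suc j)) odd even n n≥1
  where
  even : ∀ h → OddBinomialForm (suc (suc (2 * h))) (suc j)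
  even h n%2≡1 = contradiction (trans (sym n%2≡1) ([2+2n]%2≡0 h)) λ ()
  odd : ∀ h → OddBinomialForm (suc (2 * h)) (suc j)
  odd h _ = trans (closed-form-odd h j)
    (frac-den-as-binomials (T (suc (2 * h)) (suc j)) j h (suc (2 * h) + j) (h + j)
      (2 * h / 2 + suc j ∸ 1) (suc (2 * h) + 2 * suc j ∸ 2) (2 * h / 2) (+-comm j h) j+a≡c x≡b y≡c (2*n/2≡n h))
    where
    j+a≡c : j + (suc (2 * h) + j) ≡ suc (2 * (h + j))
    j+a≡c = solve (h ∷ j ∷ []) ℕ-ring
    x≡b : 2 * h / 2 + suc j ∸ 1 ≡ h + j
    x≡b = trans (cong (λ x → x + suc j ∸ 1) (2*n/2≡n h)) (cong (_∸ 1) (+-suc h j))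
    n+2k≡3+2b : suc (2 * h) + 2 * suc j ≡ suc (suc (suc (2 * (h + j))))
    n+2k≡3+2b = solve (h ∷ j ∷ []) ℕ-ring
    y≡c : suc (2 * h) + 2 * suc j ∸ 2 ≡ suc (2 * (h + j))
    y≡c = cong (_∸ 2) n+2k≡3+2b

P-even-binomial-form : ∀ n k → 1 ≤ n → 1 ≤ k → EvenBinomialForm n k
P-even-binomial-form n (suc j) n≥1 _ = parity-cases (λ n → EvenBinomialForm n (suc j)) odd even n n≥1
  where
  odd : ∀ h → EvenBinomialForm (suc (2 * h)) (suc j)
  odd h n%2≡0 = contradiction (trans (sym ([1+2n]%2≡1 h)) n%2≡0) λ ()
  even : ∀ h → EvenBinomialForm (suc (suc (2 * h))) (suc j)
  even h _ = trans (closed-form-even h j)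
    (frac-den-as-binomials (T (suc (suc (2 * h))) (suc j)) (suc j) h (suc (suc (2 * h)) + j) (suc (h + j))
      (suc (suc (2 * h)) / 2 + suc j ∸ 1) (suc (suc (2 * h)) + 2 * suc j ∸ 1) (suc (suc (2 * h)) / 2 ∸ 1)
      (cong suc (+-comm j h)) k+a≡c x≡b y≡c (cong (_∸ 1) ([2+2n]/2≡1+n h)))
    where
    k+a≡c : suc j + (suc (suc (2 * h)) + j) ≡ suc (2 * suc (h + j))
    k+a≡c = solve (h ∷ j ∷ []) ℕ-ring
    x≡b : suc (suc (2 * h)) / 2 + suc j ∸ 1 ≡ suc (h + j)
    x≡b = trans (cong (λ x → x + suc j ∸ 1) ([2+2n]/2≡1+n h)) (+-suc h j)
    n+2k≡2+2b : suc (suc (2 * h)) + 2 * suc j ≡ suc (suc (2 * suc (h + j)))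
    n+2k≡2+2b = solve (h ∷ j ∷ []) ℕ-ring
    y≡c : suc (suc (2 * h)) + 2 * suc j ∸ 1 ≡ suc (2 * suc (h + j))
    y≡c = cong (_∸ 1) n+2k≡2+2b

P-double-factorial-form : ∀ n k → 1 ≤ n → 1 ≤ k → DoubleFactorialForm n k
P-double-factorial-form n (suc j) n≥1 _ = trans (closed-form n n≥1 j)
  (frac-den-as-double-factorial (T n (suc j)) (n + j) (n / 2 + j)
    (n / 2 + suc j ∸ 1) (n + suc j ∸ 1) (2 * (n / 2) + 2 * suc j ∸ 1)
    (cong (_∸ 1) (+-suc (n / 2) j)) (cong (_∸ 1) (+-suc n j)) (cong (_∸ 1) (2x+2[1+j]≡2+2[x+j] (n / 2) j)))
  where
  2x+2[1+j]≡2+2[x+j] : ∀ x j → 2 * x + 2 * suc j ≡ suc (suc (2 * (x + j)))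
  2x+2[1+j]≡2+2[x+j] = solve-∀ ℕ-ring

theorem1 : (n k : ℕ) → 1 ≤ n → 1 ≤ k →
    (n % 2 ≡ 1 →
    P n k ≡ ((⟦ ((n ∸ 1) / 2 + k ∸ 1) C (k ∸ 1) ⟧ ℚ.* inv ((n + 2 * k ∸ 2) C (k ∸ 1)))
    ℚ.* ⟦ ((n ∸ 1) / 2) ! ⟧) ℚ.* ⟦ T n k ⟧)
    × (n % 2 ≡ 0 →
    P n k ≡ ((⟦ (n / 2 + k ∸ 1) C k ⟧ ℚ.* inv ((n + 2 * k ∸ 1) C k))
    ℚ.* ⟦ (n / 2 ∸ 1) ! ⟧) ℚ.* ⟦ T n k ⟧)
    × (P n k ≡ ((inv (2 ^ (n / 2 + k ∸ 1)) ℚ.* ⟦ (n + k ∸ 1) ! ⟧)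
    ℚ.* inv ((2 * (n / 2) + 2 * k ∸ 1) !!)) ℚ.* ⟦ T n k ⟧)
theorem1 n k n≥1 k≥1 =
  P-odd-binomial-form n k n≥1 k≥1 , P-even-binomial-form n k n≥1 k≥1 , P-double-factorial-form n k n≥1 k≥1
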